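{- Let $n\geq 10$ and let the edges of the complete $3$-uniform hypergraph $\mathcal{K}^3_n$ be colored red and blue. Let $\mathcal{P}$ be a maximum (i.e. longest) loose path among the red edges, and let $A$ be a set of five consecutive vertices of $\mathcal{P}$. If $W=\{x_1,x_2,x_3\}$ is a set of three vertices disjoint from $V(\mathcal{P})$, then there is a blue $\varpi_S$-configuration (relative to $\mathcal{P}$) whose two end vertices lie in $W$ and with $S\subseteq A$.
   Context: A $3$-uniform loose path of length $\ell$ is a hypergraph with vertices $v_1,\dots,v_{2\ell+1}$ and edges $\{v_{2i+1},v_{2i+2},v_{2i+3}\}$, $i=0,\dots,\ell-1$; "consecutive vertices" refers to this ordering. Given a loose path $\mathcal{P}$ and vertices $x,y$ not in $\mathcal{P}$, a $\varpi_{\{v_i,v_j,v_k\}}$-configuration is a loose path with two edges $\{x,v_i,v_j\}$ and $\{v_j,v_k,y\}$ such that the vertices $v_i,v_j,v_k$ belong to (the union of) two consecutive edges of $\mathcal{P}$; $x$ and $y$ are called its end vertices. It is blue if both its edges are blue. -}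

module Defs where

open import Data.Nat using (ℕ; zero; suc; _+_; _*_; _≤_; _<_)
open import Data.Fin using (Fin)
open import Data.Product using (Σ; _×_; ∃; ∃-syntax)
open import Data.Sum using (_⊎_)
open import Relation.Binary.PropositionalEquality using (_≡_; _≢_)
open import Relation.Nullary using (¬_)

data Color : Set where
  red blue : Color

-- A 2-colouring of the edges (3-element subsets) of the complete 3-uniform
-- hypergraph on Fin n, given as a function on ordered triples that is
-- invariant under permutations (values on non-distinct triples are irrelevant).
record Coloring (n : ℕ) : Set where
  field
    col   : Fin n → Fin n → Fin n → Color
    sym₁₂ : ∀ x y z → col x y z ≡ col y x z
    sym₂₃ : ∀ x y z → col x y z ≡ col x z y
open Coloring public

-- A red loose path of length ℓ: vertices v 0, …, v (2ℓ) (0-indexed; values of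
-- v beyond 2ℓ are irrelevant), pairwise distinct, edges {v(2i),v(2i+1),v(2i+2)}.
IsRedLoosePath : {n : ℕ} → Coloring n → (ℓ : ℕ) → (ℕ → Fin n) → Set
IsRedLoosePath c ℓ v =
  (∀ i j → i ≤ 2 * ℓ → j ≤ 2 * ℓ → v i ≡ v j → i ≡ j) ×
  (∀ i → i < ℓ → col c (v (2 * i)) (v (2 * i + 1)) (v (2 * i + 2)) ≡ red)

IsMaxRedLoosePath : {n : ℕ} → Coloring n → (ℓ : ℕ) → (ℕ → Fin n) → Set
IsMaxRedLoosePath c ℓ v =
  IsRedLoosePath c ℓ v × (∀ ℓ' v' → IsRedLoosePath c ℓ' v' → ℓ' ≤ ℓ)

InPath : {n : ℕ} → (ℓ : ℕ) → (ℕ → Fin n) → Fin n → Set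
InPath ℓ v x = ∃[ i ] (i ≤ 2 * ℓ × v i ≡ x)

In3 : {n : ℕ} → Fin n → Fin n → Fin n → Fin n → Set
In3 x₁ x₂ x₃ x = (x ≡ x₁) ⊎ (x ≡ x₂) ⊎ (x ≡ x₃)

InWindow5 : ℕ → ℕ → Set
InWindow5 a i = a ≤ i × i ≤ a + 4

-- A blue ϖ_S-configuration relative to the path (ℓ, v) with end vertices x, y,
-- S = {v i, v j, v k}: x, y outside the path and distinct, i, j, k distinct
-- path indices lying in the union of two consecutive edges m, m+1 of the path
-- (i.e. in the index range 2m … 2m+4), and both edges {x,v i,v j},
-- {v j,v k,y} blue.
BlueVarpiConfig : {n : ℕ} → Coloring n → (ℓ : ℕ) → (ℕ → Fin n) →
                  (x y : Fin n) → (i j k : ℕ) → Set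
BlueVarpiConfig c ℓ v x y i j k =
  ¬ InPath ℓ v x × ¬ InPath ℓ v y × x ≢ y ×
  i ≢ j × j ≢ k × i ≢ k ×
  (∃[ m ] (suc m < ℓ × InWindow5 (2 * m) i × InWindow5 (2 * m) j × InWindow5 (2 * m) k)) ×
  col c x (v i) (v j) ≡ blue × col c (v j) (v k) y ≡ blue

-- Everything rests on one extension principle (module Splice): a red loose
-- path with k+1 edges ("detour") that runs through the 2k+1 vertices of k
-- consecutive path edges plus two fresh vertices, with the same end vertices,
-- can be spliced into the path, producing a red loose path one edge longer.
-- Hence a longest path admits no red detour (noRedDetour).  Five explicit
-- detours turn this into five forbidden red patterns (module Longest).  A
-- pigeonhole lemma over the three fresh vertices (fanPattern) shows that over
-- each half of a path edge either a blue configuration or a forbidden pattern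
-- appears, unless the "fans" are uniformly coloured; a short case analysis of
-- a window of five vertices starting at an even index (two whole edges) or at
-- an odd index (one whole edge and halves of its neighbours) concludes.

module Submission where

open import Defs
open import Data.Nat using (ℕ; zero; suc; _+_; _*_; _∸_; _≤_; _<_; z≤n; s≤s; z<s; s<s; _≟_; _<?_; _≤?_)
open import Data.Nat.Properties
open import Data.Fin using (Fin)
open import Data.Product using (_×_; _,_; proj₁; proj₂; ∃-syntax)
open import Data.Sum using (_⊎_; inj₁; inj₂)
open import Data.Unit using (⊤; tt)
open import Data.Empty using (⊥; ⊥-elim)
open import Function using (_∘_)
open import Relation.Binary.PropositionalEquality
open import Relation.Nullary using (¬_; Dec; yes; no; contradiction)
open import Relation.Nullary.Decidable
  using (True; toWitness; map′; ¬?; _×-dec_; _→-dec_)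
open import Data.Nat.Solver using (module +-*-Solver)
open +-*-Solver using (solve; _:+_; _:*_; con; _:=_)

edgeColour : {n : ℕ} → Coloring n → (ℕ → Fin n) → ℕ → Color
edgeColour c u i = col c (u (2 * i)) (u (2 * i + 1)) (u (2 * i + 2))

col-cong : ∀ {n} (c : Coloring n) {a a' b b' d d' : Fin n} →
  a ≡ a' → b ≡ b' → d ≡ d' → col c a b d ≡ col c a' b' d'
col-cong c refl refl refl = refl

edgeColour-cong : ∀ {n} (c : Coloring n) (u u' : ℕ → Fin n) (i j : ℕ) →
  (∀ r → r ≤ 2 → u (2 * i + r) ≡ u' (2 * j + r)) → edgeColour c u i ≡ edgeColour c u' j
edgeColour-cong c u u' i j same = col-cong c first (same 1 (s≤s z≤n)) (same 2 (s≤s (s≤s z≤n)))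
  where
    first : u (2 * i) ≡ u' (2 * j)
    first = subst₂ (λ a b → u a ≡ u' b) (+-identityʳ (2 * i)) (+-identityʳ (2 * j)) (same 0 z≤n)

offset : ∀ m q r → 2 * (m + q) + r ≡ 2 * m + (2 * q + r)
offset = solve 3 (λ m q r → con 2 :* (m :+ q) :+ r := con 2 :* m :+ (con 2 :* q :+ r)) refl

module _ {n : ℕ} (c : Coloring n) {a b d : Fin n} {z : Color} where

  col-swap₁₂ : col c a b d ≡ z → col c b a d ≡ z
  col-swap₁₂ h = trans (sym₁₂ c b a d) h

  col-swap₂₃ : col c a b d ≡ z → col c a d b ≡ z
  col-swap₂₃ h = trans (sym₂₃ c a d b) h

  col-rotate : col c a b d ≡ z → col c b d a ≡ z
  col-rotate h = trans (trans (sym₂₃ c b d a) (sym₁₂ c b a d)) h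

FreshPair : {n : ℕ} → ℕ → (ℕ → Fin n) → Fin n → Fin n → Set
FreshPair ℓ v x y = ¬ InPath ℓ v x × ¬ InPath ℓ v y × x ≢ y

-- Codes for the vertices a detour may visit: segment vertices (by offset)
-- and the two fresh vertices.
data Code : Set where
  idx : ℕ → Code
  X Y : Code

idx-injective : ∀ {a b} → idx a ≡ idx b → a ≡ b
idx-injective refl = refl

_≟ᶜ_ : (p q : Code) → Dec (p ≡ q)
idx a ≟ᶜ idx b = map′ (cong idx) idx-injective (a ≟ b)
idx _ ≟ᶜ X     = no λ ()
idx _ ≟ᶜ Y     = no λ ()
X     ≟ᶜ idx _ = no λ ()
X     ≟ᶜ X     = yes refl
X     ≟ᶜ Y     = no λ ()
Y     ≟ᶜ idx _ = no λ ()
Y     ≟ᶜ X     = no λ ()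
Y     ≟ᶜ Y     = yes refl

Bounded : ℕ → Code → Set
Bounded b (idx j) = j ≤ b
Bounded b X       = ⊤
Bounded b Y       = ⊤

bounded? : ∀ b p → Dec (Bounded b p)
bounded? b (idx j) = j ≤? b
bounded? b X       = yes tt
bounded? b Y       = yes tt

-- A property of every o ≤ N, decided by enumeration (so that concrete
-- instances are established by evaluation).
decideUpTo : {P : ℕ → Set} → (∀ o → Dec (P o)) → ∀ N → Dec (∀ o → o ≤ N → P o)
decideUpTo P? N =
  map′ (λ h o o≤N → h (s≤s o≤N)) (λ h {o} o<1+N → h o (≤-pred o<1+N)) (allUpTo? P? (suc N))

-- A detour of size k: a loose path v₀ w₁ … w_{2k+1} v_{2k} with k+1 edges
-- through the 2k+1 segment vertices (offsets 0 … 2k) and the fresh X, Y,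
-- visiting every vertex at most once.  It replaces k consecutive path edges.
record Detour (k : ℕ) : Set where
  field
    word      : ℕ → Code
    starts    : word 0 ≡ idx 0
    ends      : word (2 * k + 2) ≡ idx (2 * k)
    bounded   : ∀ o → o ≤ 2 * k + 2 → Bounded (2 * k) (word o)
    injective : ∀ o → o ≤ 2 * k + 2 → ∀ o' → o' ≤ 2 * k + 2 → word o ≡ word o' → o ≡ o'

mkDetour : ∀ k (w : ℕ → Code) → w 0 ≡ idx 0 → w (2 * k + 2) ≡ idx (2 * k) →
  {bnd : True (decideUpTo (λ o → bounded? (2 * k) (w o)) (2 * k + 2))} →
  {inj : True (decideUpTo (λ o → decideUpTo (λ o' → (w o ≟ᶜ w o') →-dec (o ≟ o')) (2 * k + 2)) (2 * k + 2))} →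
  Detour k
mkDetour k w st en {bnd} {inj} = record
  { word = w ; starts = st ; ends = en
  ; bounded = toWitness bnd ; injective = toWitness inj }

-- The last position o ≤ N at which w takes the value p (0 if there is none).
lastIndex : (ℕ → Code) → ℕ → Code → ℕ
lastIndex w zero    p = zero
lastIndex w (suc N) p with w (suc N) ≟ᶜ p
... | yes _ = suc N
... | no  _ = lastIndex w N p

lastIndex-inverse : ∀ (w : ℕ → Code) N →
  (∀ o → o ≤ N → ∀ o' → o' ≤ N → w o ≡ w o' → o ≡ o') →
  ∀ o → o ≤ N → lastIndex w N (w o) ≡ o
lastIndex-inverse w zero    inj .zero z≤n = refl
lastIndex-inverse w (suc N) inj o o≤1+N with w (suc N) ≟ᶜ w o
... | yes same = inj (suc N) ≤-refl o o≤1+N same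
... | no  diff with m≤n⇒m<n∨m≡n o≤1+N
...   | inj₂ refl = contradiction refl diff
...   | inj₁ o<1+N = lastIndex-inverse w N inj′ o (≤-pred o<1+N)
  where
    inj′ : ∀ a → a ≤ N → ∀ b → b ≤ N → w a ≡ w b → a ≡ b
    inj′ a a≤N b b≤N = inj a (m≤n⇒m≤1+n a≤N) b (m≤n⇒m≤1+n b≤N)

-- Splicing a detour of size k into a path v in place of its edges
-- e, …, e+k-1 (vertices 2e, …, 2e+2k).  The new vertex sequence is
--   v 0 … v (2e-1),  the detour (2k+3 vertices),  v (2e+2k+1) v (2e+2k+2) …
-- and it is described by a sequence of codes, decoded into vertices.
module Splice {n : ℕ} (c : Coloring n) (ℓ : ℕ) (v : ℕ → Fin n) (x y : Fin n)
              (e k : ℕ) (D : Detour k) where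
  open Detour D

  s N : ℕ
  s = 2 * e
  N = 2 * k + 2

  shift : Code → Code
  shift (idx o) = idx (s + o)
  shift X       = X
  shift Y       = Y

  decode : Code → Fin n
  decode (idx j) = v j
  decode X       = x
  decode Y       = y

  detourVertex : ℕ → Fin n
  detourVertex o = decode (shift (word o))

  code : ℕ → Code
  code i with i <? s
  ... | yes _ = idx i
  ... | no  _ with i ∸ s ≤? N
  ...   | yes _ = shift (word (i ∸ s))
  ...   | no  _ = idx (i ∸ 2)

  spliced : ℕ → Fin n
  spliced i = decode (code i)

  data Region (i : ℕ) : Set where
    before : i < s → Region i
    inside : ∀ o → o ≤ N → i ≡ s + o → Region i
    after  : ∀ d → i ≡ s + (N + suc d) → Region i

  region : ∀ i → Region i
  region i with i <? s
  ... | yes i<s = before i<s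
  ... | no  i≮s with m≤n⇒∃[o]m+o≡n (≮⇒≥ i≮s)
  ...   | o , refl with o ≤? N
  ...     | yes o≤N = inside o o≤N refl
  ...     | no  o≰N with m≤n⇒∃[o]m+o≡n (≰⇒> o≰N)
  ...       | d , refl = after d (cong (s +_) (sym (+-suc N d)))

  code-before : ∀ {i} → i < s → code i ≡ idx i
  code-before {i} i<s with i <? s
  ... | yes _   = refl
  ... | no  i≮s = contradiction i<s i≮s

  code-inside : ∀ o → o ≤ N → code (s + o) ≡ shift (word o)
  code-inside o o≤N with s + o <? s
  ... | yes s+o<s = contradiction s+o<s (m+n≮m s o)
  ... | no  _ with s + o ∸ s ≤? N
  ...   | yes _ = cong (shift ∘ word) (m+n∸m≡n s o)
  ...   | no  ≰ = contradiction (subst (_≤ N) (sym (m+n∸m≡n s o)) o≤N) ≰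

  -- past the detour, indices are those of v shifted by two
  after-index : ∀ d → s + (N + suc d) ≡ s + (2 * k + suc d) + 2
  after-index = solve 3 (λ s k d → s :+ ((con 2 :* k :+ con 2) :+ (con 1 :+ d))
                               := s :+ (con 2 :* k :+ (con 1 :+ d)) :+ con 2) refl s k

  code-after : ∀ d → code (s + (N + suc d)) ≡ idx (s + (2 * k + suc d))
  code-after d with s + (N + suc d) <? s
  ... | yes lt = contradiction lt (m+n≮m s _)
  ... | no  _ with s + (N + suc d) ∸ s ≤? N
  ...   | yes ≤N = contradiction (subst (_≤ N) (m+n∸m≡n s _) ≤N) (m+1+n≰m N)
  ...   | no  _  = cong idx (trans (cong (_∸ 2) (after-index d)) (m+n∸n≡m _ 2))

  spliced-inside : ∀ o → o ≤ N → spliced (s + o) ≡ detourVertex o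
  spliced-inside o o≤N = cong decode (code-inside o o≤N)

  spliced-upTo-start : ∀ {i} → i ≤ s → spliced i ≡ v i
  spliced-upTo-start {i} i≤s with m≤n⇒m<n∨m≡n i≤s
  ... | inj₁ i<s  = cong decode (code-before i<s)
  ... | inj₂ refl = begin
    spliced s                     ≡⟨ cong spliced (sym (+-identityʳ s)) ⟩
    spliced (s + 0)               ≡⟨ spliced-inside 0 z≤n ⟩
    decode (shift (word 0))       ≡⟨ cong (decode ∘ shift) starts ⟩
    v (s + 0)                     ≡⟨ cong v (+-identityʳ s) ⟩
    v s                           ∎
    where open ≡-Reasoning

  spliced-fromEnd : ∀ q → spliced (s + (N + q)) ≡ v (s + (2 * k + q))
  spliced-fromEnd zero = begin
    spliced (s + (N + 0))         ≡⟨ cong (spliced ∘ (s +_)) (+-identityʳ N) ⟩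
    spliced (s + N)               ≡⟨ spliced-inside N ≤-refl ⟩
    decode (shift (word N))       ≡⟨ cong (decode ∘ shift) ends ⟩
    v (s + 2 * k)                 ≡⟨ cong (v ∘ (s +_)) (sym (+-identityʳ (2 * k))) ⟩
    v (s + (2 * k + 0))           ∎
    where open ≡-Reasoning
  spliced-fromEnd (suc d) = cong decode (code-after d)

  RedDetour : Set
  RedDetour = ∀ o → o ≤ k → edgeColour c detourVertex o ≡ red

  spliced-red : (∀ i → i < ℓ → edgeColour c v i ≡ red) → e + k ≤ ℓ → RedDetour →
                ∀ i → i < suc ℓ → edgeColour c spliced i ≡ red
  spliced-red vred e+k≤ℓ dred i i<1+ℓ with i <? e
  ... | yes i<e = trans (edgeColour-cong c spliced v i i λ r r≤2 → spliced-upTo-start (early r≤2))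
                        (vred i (≤-trans i<e (≤-trans (m≤m+n e k) e+k≤ℓ)))
    where
      early : ∀ {r} → r ≤ 2 → 2 * i + r ≤ s
      early r≤2 = ≤-trans (+-monoʳ-≤ (2 * i) r≤2)
                          (subst (_≤ s) (trans (*-suc 2 i) (+-comm 2 (2 * i))) (*-monoʳ-≤ 2 i<e))
  ... | no  i≮e with m≤n⇒∃[o]m+o≡n (≮⇒≥ i≮e)
  ...   | o , refl with o ≤? k
  ...     | yes o≤k = trans (edgeColour-cong c spliced detourVertex (e + o) o λ r r≤2 →
                               trans (cong spliced (offset e o r)) (spliced-inside (2 * o + r) (bound r≤2)))
                             (dred o o≤k)
    where
      bound : ∀ {r} → r ≤ 2 → 2 * o + r ≤ N
      bound r≤2 = +-mono-≤ (*-monoʳ-≤ 2 o≤k) r≤2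
  ...     | no  o≰k with m≤n⇒∃[o]m+o≡n (≰⇒> o≰k)
  ...       | p , refl = trans (edgeColour-cong c spliced v (e + (suc k + p)) (e + (k + p)) λ r _ →
                                  trans (cong spliced (late r)) (trans (spliced-fromEnd (2 * p + r)) (cong v (old r))))
                                (vred (e + (k + p)) (subst (_≤ ℓ) (+-suc e (k + p)) (≤-pred i<1+ℓ)))
    where
      late : ∀ r → 2 * (e + (suc k + p)) + r ≡ s + (N + (2 * p + r))
      late = solve 4 (λ e k p r → con 2 :* (e :+ ((con 1 :+ k) :+ p)) :+ r
                              := con 2 :* e :+ ((con 2 :* k :+ con 2) :+ (con 2 :* p :+ r))) refl e k p
      old : ∀ r → s + (2 * k + (2 * p + r)) ≡ 2 * (e + (k + p)) + r
      old = solve 4 (λ e k p r → con 2 :* e :+ (con 2 :* k :+ (con 2 :* p :+ r))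
                             := con 2 :* (e :+ (k :+ p)) :+ r) refl e k p

  segment-end : e + k ≤ ℓ → s + 2 * k ≤ 2 * ℓ
  segment-end e+k≤ℓ = subst (_≤ 2 * ℓ) (*-distribˡ-+ 2 e k) (*-monoʳ-≤ 2 e+k≤ℓ)

  code-bounded : e + k ≤ ℓ → ∀ i → i ≤ 2 * suc ℓ → Bounded (2 * ℓ) (code i)
  code-bounded e+k≤ℓ i i≤ with region i
  ... | before i<s rewrite code-before i<s = ≤-trans (<⇒≤ i<s) (≤-trans (m≤m+n s (2 * k)) (segment-end e+k≤ℓ))
  ... | inside o o≤N refl rewrite code-inside o o≤N = shifted (word o) (bounded o o≤N)
    where
      shifted : ∀ p → Bounded (2 * k) p → Bounded (2 * ℓ) (shift p)
      shifted (idx j) j≤2k = ≤-trans (+-monoʳ-≤ s j≤2k) (segment-end e+k≤ℓ)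
      shifted X       _    = tt
      shifted Y       _    = tt
  ... | after d refl rewrite code-after d =
    +-cancelʳ-≤ 2 _ _ (subst₂ _≤_ (after-index d) (trans (*-suc 2 ℓ) (+-comm 2 (2 * ℓ))) i≤)

  decode-injective : (∀ i j → i ≤ 2 * ℓ → j ≤ 2 * ℓ → v i ≡ v j → i ≡ j) →
    FreshPair ℓ v x y → ∀ p q → Bounded (2 * ℓ) p → Bounded (2 * ℓ) q →
    decode p ≡ decode q → p ≡ q
  decode-injective vinj _ (idx i) (idx j) i≤ j≤ same = cong idx (vinj i j i≤ j≤ same)
  decode-injective _ (x∉ , _ , _)  (idx i) X i≤ _ same = contradiction (i , i≤ , same) x∉
  decode-injective _ (_ , y∉ , _)  (idx i) Y i≤ _ same = contradiction (i , i≤ , same) y∉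
  decode-injective _ (x∉ , _ , _)  X (idx j) _ j≤ same = contradiction (j , j≤ , sym same) x∉
  decode-injective _ (_ , y∉ , _)  Y (idx j) _ j≤ same = contradiction (j , j≤ , sym same) y∉
  decode-injective _ _             X X _ _ _ = refl
  decode-injective _ _             Y Y _ _ _ = refl
  decode-injective _ (_ , _ , x≢y) X Y _ _ same = contradiction same x≢y
  decode-injective _ (_ , _ , x≢y) Y X _ _ same = contradiction (sym same) x≢y

  pos : Code → ℕ
  pos = lastIndex word N

  pos-word : ∀ o → o ≤ N → pos (word o) ≡ o
  pos-word = lastIndex-inverse word N injective

  unsplice : Code → ℕ
  unsplice (idx j) with j <? s
  ... | yes _ = j
  ... | no  _ with j ∸ s ≤? 2 * k
  ...   | yes _ = s + pos (idx (j ∸ s))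
  ...   | no  _ = j + 2
  unsplice X = s + pos X
  unsplice Y = s + pos Y

  unsplice-before : ∀ {i} → i < s → unsplice (idx i) ≡ i
  unsplice-before {i} i<s with i <? s
  ... | yes _   = refl
  ... | no  i≮s = contradiction i<s i≮s

  unsplice-shift : ∀ p → Bounded (2 * k) p → unsplice (shift p) ≡ s + pos p
  unsplice-shift (idx o) o≤2k with s + o <? s
  ... | yes s+o<s = contradiction s+o<s (m+n≮m s o)
  ... | no  _ with s + o ∸ s ≤? 2 * k
  ...   | yes _ = cong (λ j → s + pos (idx j)) (m+n∸m≡n s o)
  ...   | no  ≰ = contradiction (subst (_≤ 2 * k) (sym (m+n∸m≡n s o)) o≤2k) ≰
  unsplice-shift X _ = refl
  unsplice-shift Y _ = refl

  unsplice-after : ∀ d → unsplice (idx (s + (2 * k + suc d))) ≡ s + (N + suc d)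
  unsplice-after d with s + (2 * k + suc d) <? s
  ... | yes lt = contradiction lt (m+n≮m s _)
  ... | no  _ with s + (2 * k + suc d) ∸ s ≤? 2 * k
  ...   | yes ≤2k = contradiction (subst (_≤ 2 * k) (m+n∸m≡n s _) ≤2k) (m+1+n≰m (2 * k))
  ...   | no  _   = sym (after-index d)

  unsplice-code : ∀ i → unsplice (code i) ≡ i
  unsplice-code i with region i
  ... | before i<s = trans (cong unsplice (code-before i<s)) (unsplice-before i<s)
  ... | inside o o≤N refl = begin
    unsplice (code (s + o))          ≡⟨ cong unsplice (code-inside o o≤N) ⟩
    unsplice (shift (word o))        ≡⟨ unsplice-shift (word o) (bounded o o≤N) ⟩
    s + pos (word o)                 ≡⟨ cong (s +_) (pos-word o o≤N) ⟩
    s + o                            ∎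
    where open ≡-Reasoning
  ... | after d refl = trans (cong unsplice (code-after d)) (unsplice-after d)

  spliced-isRedLoosePath : IsRedLoosePath c ℓ v → FreshPair ℓ v x y → e + k ≤ ℓ →
                           RedDetour → IsRedLoosePath c (suc ℓ) spliced
  spliced-isRedLoosePath (vinj , vred) fresh e+k≤ℓ dred = injective-spliced , spliced-red vred e+k≤ℓ dred
    where
      injective-spliced : ∀ i j → i ≤ 2 * suc ℓ → j ≤ 2 * suc ℓ → spliced i ≡ spliced j → i ≡ j
      injective-spliced i j i≤ j≤ same = begin
        i                     ≡⟨ sym (unsplice-code i) ⟩
        unsplice (code i)     ≡⟨ cong unsplice (decode-injective vinj fresh (code i) (code j)
                                   (code-bounded e+k≤ℓ i i≤) (code-bounded e+k≤ℓ j j≤) same) ⟩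
        unsplice (code j)     ≡⟨ unsplice-code j ⟩
        j                     ∎
        where open ≡-Reasoning

noRedDetour : ∀ {n} {c : Coloring n} {ℓ} {v : ℕ → Fin n} → IsMaxRedLoosePath c ℓ v →
  ∀ {x y} → FreshPair ℓ v x y → ∀ e {k} → e + k ≤ ℓ → (D : Detour k) →
  ¬ Splice.RedDetour c ℓ v x y e k D
noRedDetour {c = c} {ℓ} {v} (path , longest) {x} {y} fresh e {k} e+k≤ℓ D dred =
  n≮n ℓ (longest (suc ℓ) (Splice.spliced c ℓ v x y e k D)
    (Splice.spliced-isRedLoosePath c ℓ v x y e k D path fresh e+k≤ℓ dred))

-- The five detours used below, written as their sequence of codes
-- (offsets relative to the first replaced vertex; X, Y the fresh vertices).

detour₁ : Detour 1
detour₁ = mkDetour 1 w refl refl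
  where
    w : ℕ → Code
    w 0 = idx 0
    w 1 = X
    w 2 = idx 1
    w 3 = Y
    w _ = idx 2

detourA : Detour 2
detourA = mkDetour 2 w refl refl
  where
    w : ℕ → Code
    w 0 = idx 0
    w 1 = idx 1
    w 2 = X
    w 3 = idx 3
    w 4 = idx 2
    w 5 = Y
    w _ = idx 4

detourB : Detour 2
detourB = mkDetour 2 w refl refl
  where
    w : ℕ → Code
    w 0 = idx 0
    w 1 = idx 2
    w 2 = X
    w 3 = idx 3
    w 4 = idx 1
    w 5 = Y
    w _ = idx 4

detourC : Detour 2
detourC = mkDetour 2 w refl refl
  where
    w : ℕ → Code
    w 0 = idx 0
    w 1 = Y
    w 2 = idx 2
    w 3 = idx 1
    w 4 = X
    w 5 = idx 3
    w _ = idx 4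

detourL : Detour 3
detourL = mkDetour 3 w refl refl
  where
    w : ℕ → Code
    w 0 = idx 0
    w 1 = idx 2
    w 2 = idx 1
    w 3 = X
    w 4 = idx 3
    w 5 = Y
    w 6 = idx 5
    w 7 = idx 4
    w _ = idx 6

byColour : {A : Set} (z : Color) → (z ≡ blue → A) → (z ≡ red → A) → A
byColour blue isBlue _     = isBlue refl
byColour red  _      isRed = isRed refl

data Ix : Set where
  I₁ I₂ I₃ : Ix

-- Colours of the "fans" over two consecutive pairs of a path edge v₀v₁v₂:
-- α i is the colour of {xᵢ, v₀, v₁} and β i that of {xᵢ, v₁, v₂}.
data FanPattern (α β : Ix → Color) : Set where
  blue-pair : ∀ i j → i ≢ j → α i ≡ blue → β j ≡ blue → FanPattern α β
  red-pair  : ∀ i j → i ≢ j → α i ≡ red  → β j ≡ red  → FanPattern α β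
  red-blue  : (∀ i → α i ≡ red)  → (∀ i → β i ≡ blue) → FanPattern α β
  blue-red  : (∀ i → α i ≡ blue) → (∀ i → β i ≡ red)  → FanPattern α β

fanPattern : (α β : Ix → Color) → FanPattern α β
fanPattern α β with α I₁ in a₁
fanPattern α β | red with β I₂ in b₂
... | red = red-pair I₁ I₂ (λ ()) a₁ b₂
... | blue with β I₃ in b₃
...   | red = red-pair I₁ I₃ (λ ()) a₁ b₃
...   | blue with α I₃ in a₃
...     | blue = blue-pair I₃ I₂ (λ ()) a₃ b₂
...     | red with α I₂ in a₂
...       | blue = blue-pair I₂ I₃ (λ ()) a₂ b₃
...       | red with β I₁ in b₁
...         | red  = red-pair I₂ I₁ (λ ()) a₂ b₁
...         | blue = red-blue (λ { I₁ → a₁ ; I₂ → a₂ ; I₃ → a₃ }) (λ { I₁ → b₁ ; I₂ → b₂ ; I₃ → b₃ })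
fanPattern α β | blue with β I₂ in b₂
... | blue = blue-pair I₁ I₂ (λ ()) a₁ b₂
... | red with β I₃ in b₃
...   | blue = blue-pair I₁ I₃ (λ ()) a₁ b₃
...   | red with α I₃ in a₃
...     | red = red-pair I₃ I₂ (λ ()) a₃ b₂
...     | blue with α I₂ in a₂
...       | red = red-pair I₂ I₃ (λ ()) a₂ b₃
...       | blue with β I₁ in b₁
...         | blue = blue-pair I₂ I₁ (λ ()) a₂ b₁
...         | red  = blue-red (λ { I₁ → a₁ ; I₂ → a₂ ; I₃ → a₃ }) (λ { I₁ → b₁ ; I₂ → b₂ ; I₃ → b₃ })

-- Offsets a, b, d from a base vertex that are distinct, lie in the window of
-- five starting at offset r, and lie in the two consecutive edges starting at
-- offset 2q: the shape of a ϖ-configuration inside a given window.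
Placement : (q r a b d : ℕ) → Set
Placement q r a b d =
  (a ≢ b × b ≢ d × a ≢ d) ×
  (InWindow5 r a × InWindow5 r b × InWindow5 r d) ×
  (InWindow5 (2 * q) a × InWindow5 (2 * q) b × InWindow5 (2 * q) d)

inWindow5? : ∀ a i → Dec (InWindow5 a i)
inWindow5? a i = (a ≤? i) ×-dec (i ≤? a + 4)

placement? : ∀ q r a b d → Dec (Placement q r a b d)
placement? q r a b d =
  (¬? (a ≟ b) ×-dec ¬? (b ≟ d) ×-dec ¬? (a ≟ d)) ×-dec
  (inWindow5? r a ×-dec inWindow5? r b ×-dec inWindow5? r d) ×-dec
  (inWindow5? (2 * q) a ×-dec inWindow5? (2 * q) b ×-dec inWindow5? (2 * q) d)

InWindow5-translate : ∀ t {r o : ℕ} → InWindow5 r o → InWindow5 (t + r) (t + o)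
InWindow5-translate t {r} {o} (r≤o , o≤r+4) =
  +-monoʳ-≤ t r≤o , subst (t + o ≤_) (sym (+-assoc t r 4)) (+-monoʳ-≤ t o≤r+4)

parity : ∀ a → ∃[ m ] (a ≡ 2 * m + 0 ⊎ a ≡ 2 * m + 1)
parity zero = 0 , inj₁ refl
parity (suc a) with parity a
... | m , inj₁ refl = m , inj₂ (trans (cong suc (+-identityʳ (2 * m))) (+-comm 1 (2 * m)))
... | m , inj₂ refl = suc m , inj₁ (solve 1 (λ m → con 1 :+ (con 2 :* m :+ con 1)
                                                := con 2 :* (con 1 :+ m) :+ con 0) refl m)

evenWindowBound : ∀ m ℓ → 2 * m + 0 + 4 ≤ 2 * ℓ → m + 2 ≤ ℓ
evenWindowBound m ℓ h = *-cancelˡ-≤ 2 (subst (_≤ 2 * ℓ) shape h)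
  where
    shape : 2 * m + 0 + 4 ≡ 2 * (m + 2)
    shape = solve 1 (λ m → con 2 :* m :+ con 0 :+ con 4 := con 2 :* (m :+ con 2)) refl m

oddWindowBound : ∀ m ℓ → 2 * m + 1 + 4 ≤ 2 * ℓ → m + 3 ≤ ℓ
oddWindowBound m ℓ h with m + 3 ≤? ℓ
... | yes fits = fits
... | no  ¬fits = contradiction h (<⇒≱ (subst (suc (2 * ℓ) ≤_) (sym shape) (s≤s (*-monoʳ-≤ 2 ℓ≤m+2))))
  where
    ℓ≤m+2 : ℓ ≤ m + 2
    ℓ≤m+2 = ≤-pred (subst (ℓ <_) (+-suc m 2) (≰⇒> ¬fits))
    shape : 2 * m + 1 + 4 ≡ suc (2 * (m + 2))
    shape = solve 1 (λ m → con 2 :* m :+ con 1 :+ con 4 := con 1 :+ con 2 :* (m :+ con 2)) refl m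

module Longest {n : ℕ} {c : Coloring n} {ℓ : ℕ} {v : ℕ → Fin n}
               (longest : IsMaxRedLoosePath c ℓ v) where

  noDetour : ∀ {x y} → FreshPair ℓ v x y → ∀ e {k} → e + k ≤ ℓ → (D : Detour k) →
             ¬ Splice.RedDetour c ℓ v x y e k D
  noDetour = noRedDetour {c = c} {ℓ} {v} longest

  edgeBelow : ∀ {m k} → m + k ≤ ℓ → ∀ {q} → q < k → m + q < ℓ
  edgeBelow {m} bound q<k = <-≤-trans (+-monoʳ-< m q<k) bound

  pathEdge : ∀ m q → m + q < ℓ →
    col c (v (2 * m + (2 * q + 0))) (v (2 * m + (2 * q + 1))) (v (2 * m + (2 * q + 2))) ≡ red
  pathEdge m q m+q<ℓ =
    trans (col-cong c (cong v (trans (sym (offset m q 0)) (+-identityʳ _)))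
                      (cong v (sym (offset m q 1))) (cong v (sym (offset m q 2))))
          (proj₂ (proj₁ longest) (m + q) m+q<ℓ)

  noRedFanPair : ∀ {x y} → FreshPair ℓ v x y → ∀ m q → m + q < ℓ →
    col c x (v (2 * m + (2 * q + 0))) (v (2 * m + (2 * q + 1))) ≡ red →
    col c y (v (2 * m + (2 * q + 1))) (v (2 * m + (2 * q + 2))) ≡ red → ⊥
  noRedFanPair fresh m q m+q<ℓ r₁ r₂ =
    noDetour fresh (m + q) (subst (_≤ ℓ) (+-comm 1 (m + q)) m+q<ℓ) detour₁ λ
      { 0 _ → trans (col-cong c (at 0) refl (at 1)) (col-swap₁₂ c r₁)
      ; 1 _ → trans (col-cong c (at 1) refl (at 2)) (col-swap₁₂ c r₂)
      ; (suc (suc _)) (s≤s ()) }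
    where
      at : ∀ r → v (2 * (m + q) + r) ≡ v (2 * m + (2 * q + r))
      at r = cong v (offset m q r)

  noRedA : ∀ {x y} → FreshPair ℓ v x y → ∀ m → m + 2 ≤ ℓ →
    col c x (v (2 * m + 0)) (v (2 * m + 1)) ≡ red →
    col c x (v (2 * m + 2)) (v (2 * m + 3)) ≡ red →
    col c y (v (2 * m + 2)) (v (2 * m + 4)) ≡ red → ⊥
  noRedA fresh m bound r₁ r₂ r₃ = noDetour fresh m bound detourA λ
    { 0 _ → col-rotate c r₁ ; 1 _ → col-swap₂₃ c r₂ ; 2 _ → col-swap₁₂ c r₃
    ; (suc (suc (suc _))) (s≤s (s≤s ())) }

  noRedB : ∀ {x y} → FreshPair ℓ v x y → ∀ m → m + 2 ≤ ℓ →
    col c x (v (2 * m + 0)) (v (2 * m + 2)) ≡ red →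
    col c x (v (2 * m + 1)) (v (2 * m + 3)) ≡ red →
    col c y (v (2 * m + 1)) (v (2 * m + 4)) ≡ red → ⊥
  noRedB fresh m bound r₁ r₂ r₃ = noDetour fresh m bound detourB λ
    { 0 _ → col-rotate c r₁ ; 1 _ → col-swap₂₃ c r₂ ; 2 _ → col-swap₁₂ c r₃
    ; (suc (suc (suc _))) (s≤s (s≤s ())) }

  noRedC : ∀ {x y} → FreshPair ℓ v x y → ∀ m → m + 2 ≤ ℓ →
    col c y (v (2 * m + 0)) (v (2 * m + 2)) ≡ red →
    col c x (v (2 * m + 1)) (v (2 * m + 2)) ≡ red →
    col c x (v (2 * m + 3)) (v (2 * m + 4)) ≡ red → ⊥
  noRedC fresh m bound r₁ r₂ r₃ = noDetour fresh m bound detourC λ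
    { 0 _ → col-swap₁₂ c r₁ ; 1 _ → col-rotate c (col-swap₂₃ c r₂) ; 2 _ → r₃
    ; (suc (suc (suc _))) (s≤s (s≤s ())) }

  -- {x,v₁,v₃}, {y,v₃,v₅} red over the edges m, m+1, m+2  (detourL, which
  -- reuses the red path edges m and m+2)
  noRedL : ∀ {x y} → FreshPair ℓ v x y → ∀ m → m + 3 ≤ ℓ →
    col c x (v (2 * m + 1)) (v (2 * m + 3)) ≡ red →
    col c y (v (2 * m + 3)) (v (2 * m + 5)) ≡ red → ⊥
  noRedL fresh m bound r₁ r₂ = noDetour fresh m bound detourL λ
    { 0 _ → col-swap₂₃ c (pathEdge m 0 (edgeBelow bound z<s))
    ; 1 _ → col-swap₁₂ c r₁ ; 2 _ → col-swap₁₂ c r₂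
    ; 3 _ → col-swap₁₂ c (pathEdge m 2 (edgeBelow bound (s<s (s<s z<s))))
    ; (suc (suc (suc (suc _)))) (s≤s (s≤s (s≤s ()))) }

  module Witnesses (x₁ x₂ x₃ : Fin n) (d₁₂ : x₁ ≢ x₂) (d₁₃ : x₁ ≢ x₃) (d₂₃ : x₂ ≢ x₃)
                   (x₁∉ : ¬ InPath ℓ v x₁) (x₂∉ : ¬ InPath ℓ v x₂) (x₃∉ : ¬ InPath ℓ v x₃) where

    xs : Ix → Fin n
    xs I₁ = x₁
    xs I₂ = x₂
    xs I₃ = x₃

    xs-in : ∀ i → In3 x₁ x₂ x₃ (xs i)
    xs-in I₁ = inj₁ refl
    xs-in I₂ = inj₂ (inj₁ refl)
    xs-in I₃ = inj₂ (inj₂ refl)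

    xs-fresh : ∀ i → ¬ InPath ℓ v (xs i)
    xs-fresh I₁ = x₁∉
    xs-fresh I₂ = x₂∉
    xs-fresh I₃ = x₃∉

    xs-distinct : ∀ i j → i ≢ j → xs i ≢ xs j
    xs-distinct I₁ I₁ i≢j = contradiction refl i≢j
    xs-distinct I₂ I₂ i≢j = contradiction refl i≢j
    xs-distinct I₃ I₃ i≢j = contradiction refl i≢j
    xs-distinct I₁ I₂ _ = d₁₂
    xs-distinct I₁ I₃ _ = d₁₃
    xs-distinct I₂ I₃ _ = d₂₃
    xs-distinct I₂ I₁ _ = d₁₂ ∘ sym
    xs-distinct I₃ I₁ _ = d₁₃ ∘ sym
    xs-distinct I₃ I₂ _ = d₂₃ ∘ sym

    pair : ∀ i j → i ≢ j → FreshPair ℓ v (xs i) (xs j)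
    pair i j i≢j = xs-fresh i , xs-fresh j , xs-distinct i j i≢j

    Goal : ℕ → Set
    Goal a = ∃[ x ] ∃[ y ] ∃[ i ] ∃[ j ] ∃[ k ]
      (In3 x₁ x₂ x₃ x × In3 x₁ x₂ x₃ y ×
       InWindow5 a i × InWindow5 a j × InWindow5 a k ×
       BlueVarpiConfig c ℓ v x y i j k)

    fan : ℕ → ℕ → ℕ → Ix → Color
    fan m a b i = col c (xs i) (v (2 * m + a)) (v (2 * m + b))

    blueConfig : ∀ m q r → m + suc q < ℓ → ∀ i j → i ≢ j → ∀ a b d →
      {True (placement? q r a b d)} →
      fan m a b i ≡ blue → fan m b d j ≡ blue → Goal (2 * m + r)
    blueConfig m q r bound i j i≢j a b d {ok} blue₁ blue₂ with toWitness ok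
    ... | (a≢b , b≢d , a≢d) , (ra , rb , rd) , (qa , qb , qd) =
      xs i , xs j , 2 * m + a , 2 * m + b , 2 * m + d , xs-in i , xs-in j ,
      InWindow5-translate (2 * m) ra , InWindow5-translate (2 * m) rb , InWindow5-translate (2 * m) rd ,
      xs-fresh i , xs-fresh j , xs-distinct i j i≢j ,
      shifted≢ a≢b , shifted≢ b≢d , shifted≢ a≢d ,
      (m + q , subst (_< ℓ) (+-suc m q) bound , inEdges qa , inEdges qb , inEdges qd) ,
      blue₁ , col-rotate c blue₂
      where
        shifted≢ : ∀ {o o'} → o ≢ o' → 2 * m + o ≢ 2 * m + o'
        shifted≢ o≢o' same = o≢o' (+-cancelˡ-≡ (2 * m) _ _ same)
        inEdges : ∀ {o} → InWindow5 (2 * q) o → InWindow5 (2 * (m + q)) (2 * m + o)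
        inEdges {o} h = subst (λ w → InWindow5 w (2 * m + o)) (sym (*-distribˡ-+ 2 m q)) (InWindow5-translate (2 * m) h)

    -- The window v(2m), …, v(2m+4) is the union of the edges m and m+1.
    module EvenWindow (m : ℕ) (bound : m + 2 ≤ ℓ) where

      config : ∀ i j → i ≢ j → ∀ a b d → {True (placement? 0 0 a b d)} →
               fan m a b i ≡ blue → fan m b d j ≡ blue → Goal (2 * m + 0)
      config = blueConfig m 0 0 (edgeBelow bound (s<s z<s))

      redBlueTwice : fan m 0 1 I₁ ≡ red → fan m 1 2 I₁ ≡ blue → fan m 2 3 I₁ ≡ red → Goal (2 * m + 0)
      redBlueTwice r₀₁ b₁₂ r₂₃ = byColour (fan m 2 4 I₂)
        (λ b₂₄ → config I₂ I₁ (λ ()) 4 2 1 (col-swap₂₃ c b₂₄) (col-swap₂₃ c b₁₂))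
        (λ r₂₄ → ⊥-elim (noRedA (pair I₁ I₂ (λ ())) m bound r₀₁ r₂₃ r₂₄))

      blueRedThenRedBlue : (∀ i → fan m 0 1 i ≡ blue) → Goal (2 * m + 0)
      blueRedThenRedBlue b₀₁ =
        byColour (fan m 0 2 I₁) (λ b₀₂ → config I₂ I₁ (λ ()) 1 0 2 (col-swap₂₃ c (b₀₁ I₂)) b₀₂) λ r₀₂ →
        byColour (fan m 1 3 I₁) (λ b₁₃ → config I₂ I₁ (λ ()) 0 1 3 (b₀₁ I₂) b₁₃) λ r₁₃ →
        byColour (fan m 1 4 I₂) (λ b₁₄ → config I₁ I₂ (λ ()) 0 1 4 (b₀₁ I₁) b₁₄) λ r₁₄ →
        ⊥-elim (noRedB (pair I₁ I₂ (λ ())) m bound r₀₂ r₁₃ r₁₄)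

      blueRedTwice : fan m 1 2 I₁ ≡ red → fan m 2 3 I₁ ≡ blue → fan m 3 4 I₁ ≡ red → Goal (2 * m + 0)
      blueRedTwice r₁₂ b₂₃ r₃₄ = byColour (fan m 0 2 I₂)
        (λ b₀₂ → config I₂ I₁ (λ ()) 0 2 3 b₀₂ b₂₃)
        (λ r₀₂ → ⊥-elim (noRedC (pair I₁ I₂ (λ ())) m bound r₀₂ r₁₂ r₃₄))

      -- fan patterns over both edges: a blue pair is a configuration, a red
      -- pair a forbidden pattern, and the uniform patterns are treated above
      window : Goal (2 * m + 0)
      window with fanPattern (fan m 0 1) (fan m 1 2) | fanPattern (fan m 2 3) (fan m 3 4)
      ... | blue-pair i j i≢j b₁ b₂ | _ = config i j i≢j 0 1 2 b₁ b₂
      ... | red-pair i j i≢j r₁ r₂  | _ = ⊥-elim (noRedFanPair (pair i j i≢j) m 0 (edgeBelow bound z<s) r₁ r₂)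
      ... | _ | blue-pair i j i≢j b₁ b₂ = config i j i≢j 2 3 4 b₁ b₂
      ... | _ | red-pair i j i≢j r₁ r₂  = ⊥-elim (noRedFanPair (pair i j i≢j) m 1 (edgeBelow bound (s<s z<s)) r₁ r₂)
      ... | red-blue _ b₁₂  | blue-red b₂₃ _ = config I₁ I₂ (λ ()) 1 2 3 (b₁₂ I₁) (b₂₃ I₂)
      ... | red-blue r₀₁ b₁₂ | red-blue r₂₃ _ = redBlueTwice (r₀₁ I₁) (b₁₂ I₁) (r₂₃ I₁)
      ... | blue-red b₀₁ _  | red-blue _ _   = blueRedThenRedBlue b₀₁
      ... | blue-red _ r₁₂  | blue-red b₂₃ r₃₄ = blueRedTwice (r₁₂ I₁) (b₂₃ I₁) (r₃₄ I₁)

    -- The window v(2m+1), …, v(2m+5) contains the edge m+1 and meets m, m+2.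
    module OddWindow (m : ℕ) (bound : m + 3 ≤ ℓ) where

      config₀ : ∀ i j → i ≢ j → ∀ a b d → {True (placement? 0 1 a b d)} →
                fan m a b i ≡ blue → fan m b d j ≡ blue → Goal (2 * m + 1)
      config₀ = blueConfig m 0 1 (edgeBelow bound (s<s z<s))

      config₁ : ∀ i j → i ≢ j → ∀ a b d → {True (placement? 1 1 a b d)} →
                fan m a b i ≡ blue → fan m b d j ≡ blue → Goal (2 * m + 1)
      config₁ = blueConfig m 1 1 (edgeBelow bound (s<s (s<s z<s)))

      acrossMiddle : (fan m 1 3 I₁ ≡ blue → Goal (2 * m + 1)) →
                     (fan m 3 5 I₂ ≡ blue → Goal (2 * m + 1)) → Goal (2 * m + 1)
      acrossMiddle k₁ k₂ =
        byColour (fan m 1 3 I₁) k₁ λ r₁₃ →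
        byColour (fan m 3 5 I₂) k₂ λ r₃₅ →
        ⊥-elim (noRedL (pair I₁ I₂ (λ ())) m bound r₁₃ r₃₅)

      -- fan patterns over the middle edge m+1; in the uniform cases one of
      -- the two fans supplies the blue triple meeting acrossMiddle's outcome
      window : Goal (2 * m + 1)
      window with fanPattern (fan m 2 3) (fan m 3 4)
      ... | blue-pair i j i≢j b₁ b₂ = config₀ i j i≢j 2 3 4 b₁ b₂
      ... | red-pair i j i≢j r₁ r₂  = ⊥-elim (noRedFanPair (pair i j i≢j) m 1 (edgeBelow bound (s<s z<s)) r₁ r₂)
      ... | red-blue _ b₃₄ = acrossMiddle
        (λ b₁₃ → config₀ I₂ I₁ (λ ()) 4 3 1 (col-swap₂₃ c (b₃₄ I₂)) (col-swap₂₃ c b₁₃))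
        (λ b₃₅ → config₁ I₁ I₂ (λ ()) 4 3 5 (col-swap₂₃ c (b₃₄ I₁)) b₃₅)
      ... | blue-red b₂₃ _ = acrossMiddle
        (λ b₁₃ → config₀ I₂ I₁ (λ ()) 2 3 1 (b₂₃ I₂) (col-swap₂₃ c b₁₃))
        (λ b₃₅ → config₁ I₁ I₂ (λ ()) 2 3 5 (b₂₃ I₁) b₃₅)

    anyWindow : ∀ a → a + 4 ≤ 2 * ℓ → Goal a
    anyWindow a a+4≤2ℓ with parity a
    ... | m , inj₁ refl = EvenWindow.window m (evenWindowBound m ℓ a+4≤2ℓ)
    ... | m , inj₂ refl = OddWindow.window m (oddWindowBound m ℓ a+4≤2ℓ)

mainTheorem3 : (n : ℕ) → 10 ≤ n → (c : Coloring n) →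
    (ℓ : ℕ) (v : ℕ → Fin n) → IsMaxRedLoosePath c ℓ v →
    (a : ℕ) → a + 4 ≤ 2 * ℓ →
    (x₁ x₂ x₃ : Fin n) → x₁ ≢ x₂ → x₁ ≢ x₃ → x₂ ≢ x₃ →
    ¬ InPath ℓ v x₁ → ¬ InPath ℓ v x₂ → ¬ InPath ℓ v x₃ →
    ∃[ x ] ∃[ y ] ∃[ i ] ∃[ j ] ∃[ k ]
      (In3 x₁ x₂ x₃ x × In3 x₁ x₂ x₃ y ×
       InWindow5 a i × InWindow5 a j × InWindow5 a k ×
       BlueVarpiConfig c ℓ v x y i j k)
mainTheorem3 n _ c ℓ v longest a a+4≤2ℓ x₁ x₂ x₃ d₁₂ d₁₃ d₂₃ x₁∉ x₂∉ x₃∉ =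
  Longest.Witnesses.anyWindow {c = c} {ℓ} {v} longest x₁ x₂ x₃ d₁₂ d₁₃ d₂₃ x₁∉ x₂∉ x₃∉ a a+4≤2ℓ
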